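{- Let $(E,\sqsubseteq)$ be a complete lattice with top element $\top$ and $\Phi\colon E\to E$ monotonic. If $\Phi^{\lfloor n\rfloor}(\top)=\mathrm{lfp}\,\Phi$ for some $n\in\mathbb{N}$, then for every $f\in E$: if $\mathrm{lfp}\,\Phi\sqsubseteq f$, then $f$ is $m$-inductive for some $m\in\mathbb{N}$.
   Context: $\Phi^{\lfloor n\rfloor}(\top)$ is the $n$-fold application of $\Phi$ to $\top$. Let $\Psi_f(g)=\Phi(g)\sqcap f$. For $k\in\mathbb{N}$, $f$ is called $(k+1)$-inductive (for $\Phi$) if $\Phi(\Psi_f^{k}(f))\sqsubseteq f$, where $\Psi_f^{k}$ is the $k$-fold iteration of $\Psi_f$. -}

module Defs where

open import Level using (Level; _⊔_; Lift) renaming (suc to lsuc)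
open import Data.Nat using (ℕ; zero; suc)
open import Data.Product using (Σ)
open import Data.Sum using (_⊎_)
open import Data.Empty.Polymorphic using (⊥)
open import Relation.Unary using (Pred)
open import Relation.Binary.Bundles using (Poset)

record CompleteLattice (c ℓ₁ ℓ₂ : Level) : Set (lsuc (c ⊔ ℓ₁ ⊔ ℓ₂)) where
  field
    poset : Poset c ℓ₁ ℓ₂
  open Poset poset public
  field
    ⋀       : Pred Carrier (c ⊔ ℓ₁ ⊔ ℓ₂) → Carrier
    ⋀-lower : ∀ S {x} → S x → ⋀ S ≤ x
    ⋀-great : ∀ S {y} → (∀ {x} → S x → y ≤ x) → y ≤ ⋀ S

  ⊤ : Carrier
  ⊤ = ⋀ (λ _ → ⊥)

  _⊓_ : Carrier → Carrier → Carrier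
  a ⊓ b = ⋀ (λ x → Lift (c ⊔ ℓ₂) ((x ≈ a) ⊎ (x ≈ b)))

module _ {c ℓ₁ ℓ₂} (L : CompleteLattice c ℓ₁ ℓ₂) where
  open CompleteLattice L

  Monotone : (Carrier → Carrier) → Set (c ⊔ ℓ₂)
  Monotone Φ = ∀ {x y} → x ≤ y → Φ x ≤ Φ y

  iter : (Carrier → Carrier) → ℕ → Carrier → Carrier
  iter F zero    x = x
  iter F (suc n) x = F (iter F n x)

  Φ^ : (Carrier → Carrier) → ℕ → Carrier
  Φ^ Φ n = iter Φ n ⊤

  lfp : (Carrier → Carrier) → Carrier
  lfp Φ = ⋀ (λ x → Lift (c ⊔ ℓ₁) (Φ x ≤ x))

  Ψ : (Carrier → Carrier) → Carrier → Carrier → Carrier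
  Ψ Φ f g = Φ g ⊓ f

  -- SucInductive Φ k f  :⇔  f is (k+1)-inductive for Φ  :⇔  Φ(Ψ_f^k(f)) ⊑ f
  SucInductive : (Carrier → Carrier) → ℕ → Carrier → Set ℓ₂
  SucInductive Φ k f = Φ (iter (Ψ Φ f) k f) ≤ f

{-# OPTIONS --safe #-}
-- Ψ_f(g) ⊑ Φ(g), so by monotonicity Ψ_f^k(f) ⊑ Φ^k(⊤) for every k. Taking k = n with
-- Φ^n(⊤) = lfp Φ gives Φ(Ψ_f^n(f)) ⊑ Φ(lfp Φ) ⊑ lfp Φ ⊑ f: f is (n+1)-inductive.
module Submission where

open import Defs
open import Level using (Level; lift)
open import Data.Nat using (ℕ; zero; suc)
open import Data.Product using (Σ; _,_)
open import Data.Sum using (inj₁)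

module _ {c ℓ₁ ℓ₂ : Level} (L : CompleteLattice c ℓ₁ ℓ₂) where
  open CompleteLattice L

  x≤⊤ : ∀ x → x ≤ ⊤
  x≤⊤ x = ⋀-great _ (λ ())

  x⊓y≤x : ∀ x y → x ⊓ y ≤ x
  x⊓y≤x x y = ⋀-lower _ (lift (inj₁ Eq.refl))

  Φ[lfp]≤lfp : ∀ {Φ} → Monotone L Φ → Φ (lfp L Φ) ≤ lfp L Φ
  Φ[lfp]≤lfp mono = ⋀-great _ (λ { (lift Φx≤x) →
    trans (mono (⋀-lower _ (lift Φx≤x))) Φx≤x })

  iter-Ψ≤Φ^ : ∀ {Φ} → Monotone L Φ → ∀ f k → iter L (Ψ L Φ f) k f ≤ Φ^ L Φ k
  iter-Ψ≤Φ^ mono f zero    = x≤⊤ f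
  iter-Ψ≤Φ^ mono f (suc k) = trans (x⊓y≤x _ f) (mono (iter-Ψ≤Φ^ mono f k))

  Φ^≈lfp⇒sucInductive : ∀ {Φ} → Monotone L Φ → ∀ n → Φ^ L Φ n ≈ lfp L Φ →
                        ∀ {f} → lfp L Φ ≤ f → SucInductive L Φ n f
  Φ^≈lfp⇒sucInductive mono n Φ^n≈lfp {f} lfp≤f =
    trans (mono (trans (iter-Ψ≤Φ^ mono f n) (reflexive Φ^n≈lfp)))
          (trans (Φ[lfp]≤lfp mono) lfp≤f)

corollary1 : ∀ {c ℓ₁ ℓ₂ : Level} (L : CompleteLattice c ℓ₁ ℓ₂)
    → let open CompleteLattice L in
    (Φ : Carrier → Carrier) → Monotone L Φ
    → Σ ℕ (λ n → Φ^ L Φ n ≈ lfp L Φ)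
    → (f : Carrier) → lfp L Φ ≤ f
    → Σ ℕ (λ k → SucInductive L Φ k f)
corollary1 L Φ mono (n , Φ^n≈lfp) f lfp≤f = n , Φ^≈lfp⇒sucInductive L mono n Φ^n≈lfp lfp≤f
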